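{- Let $n\ge2$ and $\tau_i=(c_i,d_i,p_i,J_i)$, $i=1,\dots,n$, nonnegative integers with $c_i\ge1$, $p_i\ge1$, $c_i\le d_i\le p_i$, $0\le J_i\le p_i$, and $U:=\sum_{i<n}c_i/p_i<1$. Let $k$ be an integer and let $S$ be the largest value of $s$ among optimal solutions $(s,x)$ of \[ \min\Big\{s+\sum_{i<n}c_ix_i : s+p_ix_i\ge k+J_i\ \forall i<n,\ s\in\mathbb{Z}_{\ge0},\ x\in\mathbb{Z}^{n-1}\Big\}. \] Then $S\le\big(\sum_{i<n}c_i\big)/(1-U)$. -}

module Defs where

open import Data.Nat as ℕ using (ℕ; zero; suc)
open import Data.Integer as ℤ using (ℤ; +_)
open import Data.Rational as ℚ using (ℚ; 0ℚ)
open import Data.Rational.Properties using (_≟_)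
open import Data.Fin using (Fin; zero; suc; inject₁)
open import Relation.Nullary using (yes; no)
open import Data.Product using (_×_)

sumℤ : ∀ {m} → (Fin m → ℤ) → ℤ
sumℤ {zero}  f = + 0
sumℤ {suc m} f = f zero ℤ.+ sumℤ (λ i → f (suc i))

sumℚ : ∀ {m} → (Fin m → ℚ) → ℚ
sumℚ {zero}  f = 0ℚ
sumℚ {suc m} f = f zero ℚ.+ sumℚ (λ i → f (suc i))

-- c / p as a rational (junk value 0 when p = 0; only used with p ≥ 1)
_÷ℕ_ : ℕ → ℕ → ℚ
c ÷ℕ zero  = 0ℚ
c ÷ℕ suc p = (+ c) ℚ./ suc p

-- rational division (junk value 0 when the divisor is 0)
_÷ℚ_ : ℚ → ℚ → ℚ
a ÷ℚ b with b ≟ 0ℚ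
... | yes _  = 0ℚ
... | no b≢0 = ℚ._÷_ a b {{ℚ.≢-nonZero b≢0}}

-- Tasks are indexed by Fin (suc m), i.e. n = m + 1; the tasks "i < n" are
-- the first m ones, inject₁ i for i : Fin m.
-- U = Σ_{i<n} c_i / p_i
U : ∀ {m} (c p : Fin (suc m) → ℕ) → ℚ
U c p = sumℚ (λ i → c (inject₁ i) ÷ℕ p (inject₁ i))

module _ {m : ℕ} (c p J : Fin (suc m) → ℕ) (k : ℤ) where

  Feasible : ℕ → (Fin m → ℤ) → Set
  Feasible s x = ∀ (i : Fin m) →
    k ℤ.+ + J (inject₁ i) ℤ.≤ + s ℤ.+ + p (inject₁ i) ℤ.* x i

  objective : ℕ → (Fin m → ℤ) → ℤ
  objective s x = + s ℤ.+ sumℤ (λ i → + c (inject₁ i) ℤ.* x i)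

  Optimal : ℕ → (Fin m → ℤ) → Set
  Optimal s x = Feasible s x × (∀ s' x' → Feasible s' x' → objective s x ℤ.≤ objective s' x')

-- Given an optimal (s, x), move the demand s into the task variables: choosing q_i with
-- s ≤ p_i q_i ≤ s + p_i (e.g. q_i = ⌊s/p_i⌋ + 1), the point (0, x + q) is feasible, so optimality
-- gives s ≤ Σ c_i q_i ≤ Σ c_i (s + p_i)/p_i = U s + Σ c_i, and U < 1 turns this into
-- s ≤ Σ c_i / (1 - U).
module Submission where

open import Defs
open import Data.Nat as ℕ using (ℕ; suc; zero)
open import Data.Integer as ℤ using (ℤ; +_)
open import Data.Rational as ℚ using (ℚ; 1ℚ; 0ℚ)
open import Data.Rational.Unnormalised as ℚᵘ using (mkℚᵘ; *≡*; *≤*)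
open import Data.Fin using (Fin; zero; suc; inject₁)
open import Data.Product using (_×_; _,_; proj₁; proj₂; ∃-syntax)
open import Relation.Nullary using (yes; no; contradiction)
open import Relation.Binary.PropositionalEquality
open import Data.Nat.DivMod using (m≡m%n+[m/n]*n; m%n≤n; m/n*n≤m)
import Data.Nat.Properties as ℕP
import Data.Integer.Properties as ℤP
import Data.Rational.Properties as ℚP
import Data.Rational.Unnormalised.Properties as ℚᵘP
open import Data.Integer.Tactic.RingSolver using (solve-∀)
open import Data.Rational.Solver using (module +-*-Solver)
open import Algebra.Bundles using (CommutativeMonoid)
import Algebra.Properties.CommutativeSemigroup as CommSemigroupProperties

private
  module ℤ+ = CommSemigroupProperties ℤP.+-commutativeSemigroup
  module ℚ+ = CommSemigroupProperties (CommutativeMonoid.commutativeSemigroup ℚP.+-0-commutativeMonoid)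

∃-multiple-between : ∀ s P → 1 ℕ.≤ P → ∃[ q ] s ℕ.≤ P ℕ.* q × P ℕ.* q ℕ.≤ s ℕ.+ P
∃-multiple-between s P@(suc _) _ = suc (s ℕ./ P) , lower , upper
  where
  open ℕP.≤-Reasoning
  lower : s ℕ.≤ P ℕ.* suc (s ℕ./ P)
  lower = begin
    s                                ≡⟨ m≡m%n+[m/n]*n s P ⟩
    s ℕ.% P ℕ.+ s ℕ./ P ℕ.* P        ≤⟨ ℕP.+-monoˡ-≤ _ (m%n≤n s P) ⟩
    suc (s ℕ./ P) ℕ.* P              ≡⟨ ℕP.*-comm (suc (s ℕ./ P)) P ⟩
    P ℕ.* suc (s ℕ./ P)              ∎
  upper : P ℕ.* suc (s ℕ./ P) ℕ.≤ s ℕ.+ P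
  upper = begin
    P ℕ.* suc (s ℕ./ P)              ≡⟨ ℕP.*-comm P (suc (s ℕ./ P)) ⟩
    P ℕ.+ s ℕ./ P ℕ.* P              ≤⟨ ℕP.+-monoʳ-≤ P (m/n*n≤m s P) ⟩
    P ℕ.+ s                          ≡⟨ ℕP.+-comm P s ⟩
    s ℕ.+ P                          ∎

sumℤ-cong : ∀ {m} {f g : Fin m → ℤ} → (∀ i → f i ≡ g i) → sumℤ f ≡ sumℤ g
sumℤ-cong {zero}  f≗g = refl
sumℤ-cong {suc m} f≗g = cong₂ ℤ._+_ (f≗g zero) (sumℤ-cong (λ i → f≗g (suc i)))

sumℤ-+ : ∀ {m} (f g : Fin m → ℤ) → sumℤ (λ i → f i ℤ.+ g i) ≡ sumℤ f ℤ.+ sumℤ g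
sumℤ-+ {zero}  f g = refl
sumℤ-+ {suc m} f g = trans (cong (ℤ._+_ (f zero ℤ.+ g zero)) (sumℤ-+ (λ i → f (suc i)) (λ i → g (suc i))))
  (ℤ+.interchange (f zero) (g zero) _ _)

+-cancelʳ-≤ : ∀ {i j} k → i ℤ.+ k ℤ.≤ j ℤ.+ k → i ℤ.≤ j
+-cancelʳ-≤ {i} {j} k i+k≤j+k = subst₂ ℤ._≤_ (i+k-k≡i i k) (i+k-k≡i j k) (ℤP.+-monoˡ-≤ (ℤ.- k) i+k≤j+k)
  where
  i+k-k≡i : ∀ i k → i ℤ.+ k ℤ.+ ℤ.- k ≡ i
  i+k-k≡i = solve-∀

sumℚ-+ : ∀ {m} (f g : Fin m → ℚ) → sumℚ (λ i → f i ℚ.+ g i) ≡ sumℚ f ℚ.+ sumℚ g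
sumℚ-+ {zero}  f g = refl
sumℚ-+ {suc m} f g = trans (cong ((f zero ℚ.+ g zero) ℚ.+_) (sumℚ-+ (λ i → f (suc i)) (λ i → g (suc i))))
  (ℚ+.interchange (f zero) (g zero) _ _)

sumℚ-*ʳ : ∀ {m} (f : Fin m → ℚ) r → sumℚ (λ i → f i ℚ.* r) ≡ sumℚ f ℚ.* r
sumℚ-*ʳ {zero}  f r = sym (ℚP.*-zeroˡ r)
sumℚ-*ʳ {suc m} f r = trans (cong ((f zero ℚ.* r) ℚ.+_) (sumℚ-*ʳ (λ i → f (suc i)) r))
  (sym (ℚP.*-distribʳ-+ r (f zero) _))

sumℚ-mono-≤ : ∀ {m} {f g : Fin m → ℚ} → (∀ i → f i ℚ.≤ g i) → sumℚ f ℚ.≤ sumℚ g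
sumℚ-mono-≤ {zero}  f≤g = ℚP.≤-refl
sumℚ-mono-≤ {suc m} f≤g = ℚP.+-mono-≤ (f≤g zero) (sumℚ-mono-≤ (λ i → f≤g (suc i)))

-- a ℚ./ suc d is definitionally ℚ.fromℚᵘ (mkℚᵘ a d), so the quotients of the statement are
-- handled as images of unnormalised rationals.
fromℚᵘ-mono-≤ : ∀ {p q} → p ℚᵘ.≤ q → ℚ.fromℚᵘ p ℚ.≤ ℚ.fromℚᵘ q
fromℚᵘ-mono-≤ {p} {q} p≤q = ℚP.toℚᵘ-cancel-≤ (begin
  ℚ.toℚᵘ (ℚ.fromℚᵘ p)  ≃⟨ ℚP.toℚᵘ-fromℚᵘ p ⟩
  p                    ≤⟨ p≤q ⟩
  q                    ≃⟨ ℚP.toℚᵘ-fromℚᵘ q ⟨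
  ℚ.toℚᵘ (ℚ.fromℚᵘ q)  ∎)
  where open ℚᵘP.≤-Reasoning

fromℚᵘ-homo-+ : ∀ p q → ℚ.fromℚᵘ (p ℚᵘ.+ q) ≡ ℚ.fromℚᵘ p ℚ.+ ℚ.fromℚᵘ q
fromℚᵘ-homo-+ p q = ℚP.toℚᵘ-injective (begin-equality
  ℚ.toℚᵘ (ℚ.fromℚᵘ (p ℚᵘ.+ q))                    ≃⟨ ℚP.toℚᵘ-fromℚᵘ (p ℚᵘ.+ q) ⟩
  p ℚᵘ.+ q                                        ≃⟨ ℚᵘP.+-cong (ℚP.toℚᵘ-fromℚᵘ p) (ℚP.toℚᵘ-fromℚᵘ q) ⟨
  ℚ.toℚᵘ (ℚ.fromℚᵘ p) ℚᵘ.+ ℚ.toℚᵘ (ℚ.fromℚᵘ q)  ≃⟨ ℚP.toℚᵘ-homo-+ (ℚ.fromℚᵘ p) (ℚ.fromℚᵘ q) ⟨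
  ℚ.toℚᵘ (ℚ.fromℚᵘ p ℚ.+ ℚ.fromℚᵘ q)            ∎)
  where open ℚᵘP.≤-Reasoning

fromℚᵘ-homo-* : ∀ p q → ℚ.fromℚᵘ (p ℚᵘ.* q) ≡ ℚ.fromℚᵘ p ℚ.* ℚ.fromℚᵘ q
fromℚᵘ-homo-* p q = ℚP.toℚᵘ-injective (begin-equality
  ℚ.toℚᵘ (ℚ.fromℚᵘ (p ℚᵘ.* q))                    ≃⟨ ℚP.toℚᵘ-fromℚᵘ (p ℚᵘ.* q) ⟩
  p ℚᵘ.* q                                        ≃⟨ ℚᵘP.*-cong (ℚP.toℚᵘ-fromℚᵘ p) (ℚP.toℚᵘ-fromℚᵘ q) ⟨
  ℚ.toℚᵘ (ℚ.fromℚᵘ p) ℚᵘ.* ℚ.toℚᵘ (ℚ.fromℚᵘ q)  ≃⟨ ℚP.toℚᵘ-homo-* (ℚ.fromℚᵘ p) (ℚ.fromℚᵘ q) ⟨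
  ℚ.toℚᵘ (ℚ.fromℚᵘ p ℚ.* ℚ.fromℚᵘ q)            ∎)
  where open ℚᵘP.≤-Reasoning

/1-mono-≤ : ∀ {a b} → a ℤ.≤ b → a ℚ./ 1 ℚ.≤ b ℚ./ 1
/1-mono-≤ {a} {b} a≤b = fromℚᵘ-mono-≤ {mkℚᵘ a 0} {mkℚᵘ b 0} (*≤* (ℤP.*-monoʳ-≤-nonNeg (+ 1) a≤b))

/1-homo-+ : ∀ a b → (a ℤ.+ b) ℚ./ 1 ≡ a ℚ./ 1 ℚ.+ b ℚ./ 1
/1-homo-+ a b = trans (ℚP.fromℚᵘ-cong a+b≃a+b) (fromℚᵘ-homo-+ (mkℚᵘ a 0) (mkℚᵘ b 0))
  where
  a+b≃a+b : mkℚᵘ (a ℤ.+ b) 0 ℚᵘ.≃ mkℚᵘ a 0 ℚᵘ.+ mkℚᵘ b 0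
  a+b≃a+b = *≡* (cong (ℤ._* + 1) (sym (cong₂ ℤ._+_ (ℤP.*-identityʳ a) (ℤP.*-identityʳ b))))

sumℚ-/1 : ∀ {m} (f : Fin m → ℤ) → sumℚ (λ i → f i ℚ./ 1) ≡ sumℤ f ℚ./ 1
sumℚ-/1 {zero}  f = refl
sumℚ-/1 {suc m} f = trans (cong (f zero ℚ./ 1 ℚ.+_) (sumℚ-/1 (λ i → f (suc i))))
  (sym (/1-homo-+ (f zero) _))

c*q≤ᵘc/P*s+c : ∀ c s p' q → suc p' ℕ.* q ℕ.≤ s ℕ.+ suc p' →
  mkℚᵘ (+ (c ℕ.* q)) 0 ℚᵘ.≤ mkℚᵘ (+ c) p' ℚᵘ.* mkℚᵘ (+ s) 0 ℚᵘ.+ mkℚᵘ (+ c) 0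
c*q≤ᵘc/P*s+c c s p' q Pq≤s+P = *≤* (begin
  + (c ℕ.* q) ℤ.* + (P ℕ.* 1 ℕ.* 1)              ≡⟨ cong₂ ℤ._*_ (ℤP.pos-* c q) (cong +_ (trans (ℕP.*-identityʳ _) P*1≡P)) ⟩
  + c ℤ.* + q ℤ.* + P                            ≡⟨ reorder (+ c) (+ q) (+ P) ⟩
  + c ℤ.* (+ P ℤ.* + q)                          ≤⟨ ℤP.*-monoˡ-≤-nonNeg (+ c) Pq≤s+Pℤ ⟩
  + c ℤ.* (+ s ℤ.+ + P)                          ≡⟨ expand (+ c) (+ s) (+ P) ⟩
  (+ c ℤ.* + s ℤ.* + 1 ℤ.+ + c ℤ.* + P) ℤ.* + 1  ≡⟨ cong (λ n → (+ c ℤ.* + s ℤ.* + 1 ℤ.+ + c ℤ.* + n) ℤ.* + 1) P*1≡P ⟨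
  (+ c ℤ.* + s ℤ.* + 1 ℤ.+ + c ℤ.* + (P ℕ.* 1)) ℤ.* + 1 ∎)
  where
  open ℤP.≤-Reasoning
  P : ℕ
  P = suc p'
  P*1≡P : P ℕ.* 1 ≡ P
  P*1≡P = ℕP.*-identityʳ P
  Pq≤s+Pℤ : + P ℤ.* + q ℤ.≤ + s ℤ.+ + P
  Pq≤s+Pℤ = subst (ℤ._≤ + s ℤ.+ + P) (ℤP.pos-* P q) (ℤ.+≤+ Pq≤s+P)
  reorder : ∀ c q P → c ℤ.* q ℤ.* P ≡ c ℤ.* (P ℤ.* q)
  reorder = solve-∀
  expand : ∀ c s P → c ℤ.* (s ℤ.+ P) ≡ (c ℤ.* s ℤ.* + 1 ℤ.+ c ℤ.* P) ℤ.* + 1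
  expand = solve-∀

c*q≤c÷ℕP*s+c : ∀ c s P q → 1 ℕ.≤ P → P ℕ.* q ℕ.≤ s ℕ.+ P →
  + (c ℕ.* q) ℚ./ 1 ℚ.≤ (c ÷ℕ P) ℚ.* (+ s ℚ./ 1) ℚ.+ + c ℚ./ 1
c*q≤c÷ℕP*s+c c s (suc p') q _ Pq≤s+P = begin
  ℚ.fromℚᵘ (mkℚᵘ (+ (c ℕ.* q)) 0)                               ≤⟨ fromℚᵘ-mono-≤ (c*q≤ᵘc/P*s+c c s p' q Pq≤s+P) ⟩
  ℚ.fromℚᵘ (mkℚᵘ (+ c) p' ℚᵘ.* mkℚᵘ (+ s) 0 ℚᵘ.+ mkℚᵘ (+ c) 0)  ≡⟨ fromℚᵘ-homo-+ (mkℚᵘ (+ c) p' ℚᵘ.* mkℚᵘ (+ s) 0) (mkℚᵘ (+ c) 0) ⟩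
  ℚ.fromℚᵘ (mkℚᵘ (+ c) p' ℚᵘ.* mkℚᵘ (+ s) 0) ℚ.+ + c ℚ./ 1      ≡⟨ cong (ℚ._+ (+ c ℚ./ 1)) (fromℚᵘ-homo-* (mkℚᵘ (+ c) p') (mkℚᵘ (+ s) 0)) ⟩
  (+ c ℚ./ suc p') ℚ.* (+ s ℚ./ 1) ℚ.+ + c ℚ./ 1                ∎
  where open ℚP.≤-Reasoning

*≤⇒≤÷ℚ : ∀ {p q r} → 0ℚ ℚ.< r → p ℚ.* r ℚ.≤ q → p ℚ.≤ q ÷ℚ r
*≤⇒≤÷ℚ {p} {q} {r} r>0 pr≤q with r ℚP.≟ 0ℚ
... | yes r≡0 = contradiction (sym r≡0) (ℚP.<⇒≢ r>0)
... | no  r≢0 = ℚP.*-cancelʳ-≤-pos r {{ℚ.positive r>0}} (begin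
  p ℚ.* r                ≤⟨ pr≤q ⟩
  q                      ≡⟨ ℚP.*-identityʳ q ⟨
  q ℚ.* 1ℚ               ≡⟨ cong (q ℚ.*_) (ℚP.*-inverseˡ r) ⟨
  q ℚ.* (ℚ.1/ r ℚ.* r)   ≡⟨ ℚP.*-assoc q (ℚ.1/ r) r ⟨
  q ℚ.* ℚ.1/ r ℚ.* r     ∎)
  where
  instance _ = ℚ.≢-nonZero r≢0
  open ℚP.≤-Reasoning

p≤r*p+q⇒p≤q÷[1-r] : ∀ {p q r} → r ℚ.< 1ℚ → p ℚ.≤ r ℚ.* p ℚ.+ q → p ℚ.≤ q ÷ℚ (1ℚ ℚ.- r)
p≤r*p+q⇒p≤q÷[1-r] {p} {q} {r} r<1 p≤rp+q = *≤⇒≤÷ℚ 1-r>0 (begin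
  p ℚ.* (1ℚ ℚ.- r)           ≡⟨ solve 2 (λ p r → p :* (con 1ℚ :- r) := p :- r :* p) refl p r ⟩
  p ℚ.- r ℚ.* p              ≤⟨ ℚP.+-monoˡ-≤ (ℚ.- (r ℚ.* p)) p≤rp+q ⟩
  r ℚ.* p ℚ.+ q ℚ.- r ℚ.* p  ≡⟨ solve 3 (λ p q r → r :* p :+ q :- r :* p := q) refl p q r ⟩
  q                          ∎)
  where
  open ℚP.≤-Reasoning
  open +-*-Solver
  1-r>0 : 0ℚ ℚ.< 1ℚ ℚ.- r
  1-r>0 = subst (ℚ._< 1ℚ ℚ.- r) (ℚP.+-inverseʳ r) (ℚP.+-monoˡ-< (ℚ.- r) r<1)

shiftCost : ∀ {m} → (Fin (suc m) → ℕ) → (Fin m → ℕ) → ℤ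
shiftCost c q = sumℤ (λ i → + (c (inject₁ i) ℕ.* q i))

module _ {m : ℕ} (c p J : Fin (suc m) → ℕ) (k : ℤ) where

  feasible-shift : ∀ {s x} (q : Fin m → ℕ) → (∀ i → s ℕ.≤ p (inject₁ i) ℕ.* q i) →
    Feasible c p J k s x → Feasible c p J k 0 (λ i → x i ℤ.+ + q i)
  feasible-shift {s} {x} q s≤pq feasible i = begin
    k ℤ.+ + J (inject₁ i)             ≤⟨ feasible i ⟩
    + s ℤ.+ + P ℤ.* x i               ≤⟨ ℤP.+-monoˡ-≤ (+ P ℤ.* x i) (ℤ.+≤+ (s≤pq i)) ⟩
    + (P ℕ.* q i) ℤ.+ + P ℤ.* x i     ≡⟨ cong (ℤ._+ + P ℤ.* x i) (ℤP.pos-* P (q i)) ⟩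
    + P ℤ.* + q i ℤ.+ + P ℤ.* x i     ≡⟨ ℤP.+-comm (+ P ℤ.* + q i) (+ P ℤ.* x i) ⟩
    + P ℤ.* x i ℤ.+ + P ℤ.* + q i     ≡⟨ ℤP.*-distribˡ-+ (+ P) (x i) (+ q i) ⟨
    + P ℤ.* (x i ℤ.+ + q i)           ≡⟨ ℤP.+-identityˡ _ ⟨
    + 0 ℤ.+ + P ℤ.* (x i ℤ.+ + q i)   ∎
    where
    P : ℕ
    P = p (inject₁ i)
    open ℤP.≤-Reasoning

  optimal⇒s≤shiftCost : ∀ {s x} (q : Fin m → ℕ) → (∀ i → s ℕ.≤ p (inject₁ i) ℕ.* q i) →
    Optimal c p J k s x → + s ℤ.≤ shiftCost c q
  optimal⇒s≤shiftCost {s} {x} q s≤pq (feasible , minimal) = +-cancelʳ-≤ A (begin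
    + s ℤ.+ A                                               ≤⟨ minimal 0 _ (feasible-shift q s≤pq feasible) ⟩
    + 0 ℤ.+ sumℤ (λ i → + C i ℤ.* (x i ℤ.+ + q i))          ≡⟨ ℤP.+-identityˡ _ ⟩
    sumℤ (λ i → + C i ℤ.* (x i ℤ.+ + q i))                  ≡⟨ sumℤ-cong distrib ⟩
    sumℤ (λ i → + C i ℤ.* x i ℤ.+ + (C i ℕ.* q i))          ≡⟨ sumℤ-+ (λ i → + C i ℤ.* x i) (λ i → + (C i ℕ.* q i)) ⟩
    A ℤ.+ shiftCost c q                                     ≡⟨ ℤP.+-comm A _ ⟩
    shiftCost c q ℤ.+ A                                     ∎)
    where
    C : Fin m → ℕ
    C i = c (inject₁ i)
    A : ℤ
    A = sumℤ (λ i → + C i ℤ.* x i)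
    distrib : ∀ i → + C i ℤ.* (x i ℤ.+ + q i) ≡ + C i ℤ.* x i ℤ.+ + (C i ℕ.* q i)
    distrib i = trans (ℤP.*-distribˡ-+ (+ C i) (x i) (+ q i))
      (cong (ℤ._+_ (+ C i ℤ.* x i)) (sym (ℤP.pos-* (C i) (q i))))
    open ℤP.≤-Reasoning

lemma21 : (m : ℕ) → 1 ℕ.≤ m →
    (c d p J : Fin (suc m) → ℕ) →
    (∀ i → 1 ℕ.≤ c i) → (∀ i → 1 ℕ.≤ p i) →
    (∀ i → c i ℕ.≤ d i) → (∀ i → d i ℕ.≤ p i) → (∀ i → J i ℕ.≤ p i) →
    U c p ℚ.< 1ℚ →
    (k : ℤ) (s : ℕ) (x : Fin m → ℤ) →
    Optimal c p J k s x →
    (+ s) ℚ./ 1 ℚ.≤ (sumℤ (λ i → + c (inject₁ i)) ℚ./ 1) ÷ℚ (1ℚ ℚ.- U c p)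
lemma21 m _ c d p J _ p≥1 _ _ _ U<1 k s x optimal = p≤r*p+q⇒p≤q÷[1-r] U<1 (begin
  S                                                    ≤⟨ /1-mono-≤ (optimal⇒s≤shiftCost c p J k q s≤Pq optimal) ⟩
  shiftCost c q ℚ./ 1                                  ≡⟨ sumℚ-/1 (λ i → + (C i ℕ.* q i)) ⟨
  sumℚ (λ i → + (C i ℕ.* q i) ℚ./ 1)                   ≤⟨ sumℚ-mono-≤ (λ i → c*q≤c÷ℕP*s+c (C i) s (P i) (q i) (p≥1 (inject₁ i)) (Pq≤s+P i)) ⟩
  sumℚ (λ i → (C i ÷ℕ P i) ℚ.* S ℚ.+ + C i ℚ./ 1)      ≡⟨ sumℚ-+ (λ i → (C i ÷ℕ P i) ℚ.* S) (λ i → + C i ℚ./ 1) ⟩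
  sumℚ (λ i → (C i ÷ℕ P i) ℚ.* S) ℚ.+ sumℚ (λ i → + C i ℚ./ 1) ≡⟨ cong₂ ℚ._+_ (sumℚ-*ʳ (λ i → C i ÷ℕ P i) S) (sumℚ-/1 (λ i → + C i)) ⟩
  U c p ℚ.* S ℚ.+ sumℤ (λ i → + C i) ℚ./ 1             ∎)
  where
  open ℚP.≤-Reasoning
  S : ℚ
  S = + s ℚ./ 1
  C P : Fin m → ℕ
  C i = c (inject₁ i)
  P i = p (inject₁ i)
  multiple : ∀ i → ∃[ q ] s ℕ.≤ P i ℕ.* q × P i ℕ.* q ℕ.≤ s ℕ.+ P i
  multiple i = ∃-multiple-between s (P i) (p≥1 (inject₁ i))
  q : Fin m → ℕ
  q i = proj₁ (multiple i)
  s≤Pq : ∀ i → s ℕ.≤ P i ℕ.* q i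
  s≤Pq i = proj₁ (proj₂ (multiple i))
  Pq≤s+P : ∀ i → P i ℕ.* q i ℕ.≤ s ℕ.+ P i
  Pq≤s+P i = proj₂ (proj₂ (multiple i))
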